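{- Let $w$ be an infinite word, and let $n_0<n_1<n_2$ be three consecutive lengths of palindromic prefixes of $w$ (no palindromic prefix has length strictly between $n_0$ and $n_1$, or strictly between $n_1$ and $n_2$), with corresponding prefixes $\pi_0,\pi_1,\pi_2$. Then either $\pi_2=\pi_1\pi_0^{ -1}\pi_1$, or $n_2>n_0+n_1$.
   Context: The empty word is considered a palindrome. For finite words with $u'$ a prefix of $u$, $u'^{ -1}u$ denotes the word $u''$ with $u=u'u''$; thus $\pi_1\pi_0^{ -1}\pi_1$ is $\pi_1$ followed by the word obtained from $\pi_1$ by deleting its prefix $\pi_0$. -}

module Defs where

open import Data.Nat using (ℕ; zero; suc; _<_)
open import Data.List using (List; []; _∷_; reverse)
open import Data.Product using (_×_)
open import Relation.Binary.PropositionalEquality using (_≡_)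
open import Relation.Nullary using (¬_)

InfWord : Set → Set
InfWord A = ℕ → A

prefix : {A : Set} → InfWord A → ℕ → List A
prefix w zero    = []
prefix w (suc n) = w zero ∷ prefix (λ i → w (suc i)) n

IsPalindrome : {A : Set} → List A → Set
IsPalindrome u = reverse u ≡ u

PalPrefix : {A : Set} → InfWord A → ℕ → Set
PalPrefix w n = IsPalindrome (prefix w n)

ConsecutivePalLengths : {A : Set} → InfWord A → ℕ → ℕ → Set
ConsecutivePalLengths w m n =
  PalPrefix w m × PalPrefix w n × m < n ×
  ((k : ℕ) → m < k → k < n → ¬ PalPrefix w k)

module Submission where

open import Defs
open import Data.Nat using (ℕ; _+_; _>_)
open import Data.List using (_++_; drop)
open import Data.Sum using (_⊎_)
open import Relation.Binary.PropositionalEquality using (_≡_)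

open import Data.Nat using (zero; suc; _∸_; _<_; _≤_; z≤n; s≤s; _<?_)
open import Data.Nat.Properties
open import Data.List using (_∷_; reverse; applyUpTo; applyDownFrom)
open import Data.List.Properties using (∷-injective; reverse-applyUpTo)
open import Data.Product using (_×_; _,_; proj₁; proj₂; ∃-syntax)
open import Data.Sum using (inj₁; inj₂)
open import Data.Empty using (⊥-elim)
open import Relation.Nullary using (yes; no)
open import Relation.Binary using (tri<; tri≈; tri>)
open import Relation.Binary.PropositionalEquality
  using (refl; sym; trans; cong; cong₂; subst; module ≡-Reasoning)

-- A palindromic prefix of length n is a reflection symmetry i ↦ n − 1 − i of w
-- on [0, n).  Two such symmetries at lengths a ≤ a + d compose to the period d
-- on [0, a + d), and a third one turns that period back into a reflection.
-- Assume n₂ ≤ n₀ + n₁.  If n₂ − n₁ < n₁ − n₀ the reflections at n₁, n₂, n₁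
-- yield a palindromic prefix of length 2n₁ − n₂ in (n₀, n₁); if n₂ − n₁ > n₁ − n₀
-- those at n₀, n₁, n₂ yield one of length n₀ + n₂ − n₁ in (n₁, n₂); and if the
-- two gaps agree, the period n₁ − n₀ on [0, n₂) is exactly π₂ = π₁π₀⁻¹π₁.

private
  variable
    A : Set
    w f g : InfWord A
    a b c d k m n : ℕ

Mirror : InfWord A → ℕ → Set
Mirror w n = ∀ i j → suc (i + j) ≡ n → w i ≡ w j

prefix-cong : (∀ i → i < n → f i ≡ g i) → prefix f n ≡ prefix g n
prefix-cong {n = zero}  f≗g = refl
prefix-cong {n = suc n} f≗g =
  cong₂ _∷_ (f≗g 0 (s≤s z≤n)) (prefix-cong (λ i i<n → f≗g (suc i) (s≤s i<n)))

prefix-injective : prefix f n ≡ prefix g n → ∀ i → i < n → f i ≡ g i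
prefix-injective {n = suc n} eq zero    _         = proj₁ (∷-injective eq)
prefix-injective {n = suc n} eq (suc i) (s≤s i<n) =
  prefix-injective (proj₂ (∷-injective eq)) i i<n

prefix-++ : (w : InfWord A) (m n : ℕ) →
            prefix w (m + n) ≡ prefix w m ++ prefix (λ k → w (m + k)) n
prefix-++ w zero    n = refl
prefix-++ w (suc m) n = cong (w 0 ∷_) (prefix-++ (λ i → w (suc i)) m n)

drop-prefix : (w : InfWord A) (m n : ℕ) →
              drop m (prefix w (m + n)) ≡ prefix (λ k → w (m + k)) n
drop-prefix w zero    n = refl
drop-prefix w (suc m) n = drop-prefix (λ i → w (suc i)) m n

prefix≡applyUpTo : (w : InfWord A) (n : ℕ) → prefix w n ≡ applyUpTo w n
prefix≡applyUpTo w zero    = refl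
prefix≡applyUpTo w (suc n) = cong (w 0 ∷_) (prefix≡applyUpTo (λ i → w (suc i)) n)

applyDownFrom≡prefix : (f : ℕ → A) (n : ℕ) →
                       applyDownFrom f n ≡ prefix (λ i → f (n ∸ suc i)) n
applyDownFrom≡prefix f zero    = refl
applyDownFrom≡prefix f (suc n) = cong (f n ∷_) (applyDownFrom≡prefix f n)

reverse-prefix : (w : InfWord A) (n : ℕ) →
                 reverse (prefix w n) ≡ prefix (λ i → w (n ∸ suc i)) n
reverse-prefix w n = begin
  reverse (prefix w n)              ≡⟨ cong reverse (prefix≡applyUpTo w n) ⟩
  reverse (applyUpTo w n)           ≡⟨ reverse-applyUpTo w n ⟩
  applyDownFrom w n                 ≡⟨ applyDownFrom≡prefix w n ⟩
  prefix (λ i → w (n ∸ suc i)) n    ∎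
  where open ≡-Reasoning

palindrome⇒mirror : PalPrefix w n → Mirror w n
palindrome⇒mirror {w = w} {n = n} pal i j 1+i+j≡n = begin
  w i                ≡⟨ cong w (sym n∸[1+j]≡i) ⟩
  w (n ∸ suc j)      ≡⟨ prefix-injective (trans (sym (reverse-prefix w n)) pal) j j<n ⟩
  w j                ∎
  where
  open ≡-Reasoning
  n∸[1+j]≡i : n ∸ suc j ≡ i
  n∸[1+j]≡i = trans (cong (_∸ suc j) (sym 1+i+j≡n)) (m+n∸n≡m i j)
  j<n : j < n
  j<n = subst (j <_) 1+i+j≡n (s≤s (m≤n+m j i))

mirror⇒palindrome : Mirror w n → PalPrefix w n
mirror⇒palindrome {w = w} {n = n} mirror =
  trans (reverse-prefix w n) (prefix-cong λ i i<n → mirror (n ∸ suc i) i (reflected i<n))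
  where
  reflected : ∀ {i} → i < n → suc (n ∸ suc i + i) ≡ n
  reflected {i} i<n = trans (sym (+-suc (n ∸ suc i) i)) (m∸n+n≡m i<n)

mirror-period : Mirror w a → Mirror w (a + d) → ∀ {i} → i < a → w (d + i) ≡ w i
mirror-period {w = w} {a = a} {d = d} mirror-a mirror-a+d {i} i<a
  with t , i+1+t≡a ← m≤n⇒∃[o]m+o≡n i<a = begin
  w (d + i)   ≡⟨ sym (mirror-a+d t (d + i) shifted) ⟩
  w t         ≡⟨ sym (mirror-a i t i+1+t≡a) ⟩
  w i         ∎
  where
  open ≡-Reasoning
  shifted : suc (t + (d + i)) ≡ a + d
  shifted = begin
    suc (t + (d + i))   ≡⟨ cong suc (+-comm t (d + i)) ⟩
    suc (d + i + t)     ≡⟨ cong suc (+-assoc d i t) ⟩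
    suc (d + (i + t))   ≡⟨ sym (+-suc d (i + t)) ⟩
    d + suc (i + t)     ≡⟨ cong (d +_) i+1+t≡a ⟩
    d + a               ≡⟨ +-comm d a ⟩
    a + d               ∎

mirror-from-half : (∀ i j → suc (i + j) ≡ m → i < a → w i ≡ w j) → m ≤ a + a → Mirror w m
mirror-from-half {a = a} half m≤a+a i j 1+i+j≡m with i <? a | j <? a
... | yes i<a | _       = half i j 1+i+j≡m i<a
... | no _    | yes j<a = sym (half j i (trans (cong suc (+-comm j i)) 1+i+j≡m) j<a)
... | no i≮a  | no j≮a  = ⊥-elim (<-irrefl refl (begin-strict
  a + a           ≤⟨ +-mono-≤ (≮⇒≥ i≮a) (≮⇒≥ j≮a) ⟩
  i + j           <⟨ n<1+n (i + j) ⟩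
  suc (i + j)     ≡⟨ 1+i+j≡m ⟩
  _               ≤⟨ m≤a+a ⟩
  a + a           ∎))
  where open ≤-Reasoning

-- The reflections at a, b, c compose to the reflection at m = c + a − b; the
-- composite is defined whenever i or j lies below a, hence on all of [0, m) if m ≤ 2a.
mirror-reflect : Mirror w a → Mirror w b → Mirror w c → a ≤ b → b + m ≡ c + a →
                 m ≤ a + a → Mirror w m
mirror-reflect {w = w} {a = a} {c = c} {m = m} mirror-a mirror-b mirror-c a≤b b+m≡c+a
  with d , refl ← m≤n⇒∃[o]m+o≡n a≤b = mirror-from-half half
  where
  c≡d+m : c ≡ d + m
  c≡d+m = +-cancelʳ-≡ a c (d + m) (begin
    c + a         ≡⟨ sym b+m≡c+a ⟩
    a + d + m     ≡⟨ cong (_+ m) (+-comm a d) ⟩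
    d + a + m     ≡⟨ +-assoc d a m ⟩
    d + (a + m)   ≡⟨ cong (d +_) (+-comm a m) ⟩
    d + (m + a)   ≡⟨ sym (+-assoc d m a) ⟩
    d + m + a     ∎)
    where open ≡-Reasoning
  half : ∀ i j → suc (i + j) ≡ m → i < a → w i ≡ w j
  half i j 1+i+j≡m i<a = trans (sym (mirror-period mirror-a mirror-b i<a))
    (mirror-c (d + i) j (begin
      suc (d + i + j)     ≡⟨ cong suc (+-assoc d i j) ⟩
      suc (d + (i + j))   ≡⟨ sym (+-suc d (i + j)) ⟩
      d + suc (i + j)     ≡⟨ cong (d +_) 1+i+j≡m ⟩
      d + m               ≡⟨ sym c≡d+m ⟩
      c                   ∎))
    where open ≡-Reasoning

mirror-in-lower-gap : Mirror w a → Mirror w b → a < b → b + k < a + a →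
                      ∃[ m ] k < m × m < a × Mirror w m
mirror-in-lower-gap {a = a} {b = b} {k = k} mirror-a mirror-b a<b b+k<a+a
  with m , b+m≡a+a ← m≤n⇒∃[o]m+o≡n (≤-trans (m≤m+n b k) (<⇒≤ b+k<a+a)) =
  m , k<m , m<a , mirror-reflect mirror-a mirror-b mirror-a (<⇒≤ a<b) b+m≡a+a m≤a+a
  where
  k<m : k < m
  k<m = +-cancelˡ-< b k m (subst (b + k <_) (sym b+m≡a+a) b+k<a+a)
  m<a : m < a
  m<a = +-cancelˡ-< b m a (subst (_< b + a) (sym b+m≡a+a) (+-monoˡ-< a a<b))
  m≤a+a : m ≤ a + a
  m≤a+a = subst (m ≤_) b+m≡a+a (m≤n+m m b)

mirror-in-upper-gap : Mirror w a → Mirror w b → Mirror w c → a < b → c ≤ a + b →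
                      b + b < c + a → ∃[ m ] b < m × m < c × Mirror w m
mirror-in-upper-gap {a = a} {b = b} {c = c} mirror-a mirror-b mirror-c a<b c≤a+b b+b<c+a
  with m , b+m≡c+a ← m≤n⇒∃[o]m+o≡n (≤-trans (m≤m+n b b) (<⇒≤ b+b<c+a)) =
  m , b<m , m<c , mirror-reflect mirror-a mirror-b mirror-c (<⇒≤ a<b) b+m≡c+a m≤a+a
  where
  open ≤-Reasoning
  b<m : b < m
  b<m = +-cancelˡ-< b b m (subst (b + b <_) (sym b+m≡c+a) b+b<c+a)
  m<c : m < c
  m<c = +-cancelˡ-< b m c (begin-strict
    b + m   ≡⟨ b+m≡c+a ⟩
    c + a   <⟨ +-monoʳ-< c a<b ⟩
    c + b   ≡⟨ +-comm c b ⟩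
    b + c   ∎)
  m≤a+a : m ≤ a + a
  m≤a+a = +-cancelˡ-≤ b m (a + a) (begin
    b + m         ≡⟨ b+m≡c+a ⟩
    c + a         ≤⟨ +-monoˡ-≤ a c≤a+b ⟩
    a + b + a     ≡⟨ cong (_+ a) (+-comm a b) ⟩
    b + a + a     ≡⟨ +-assoc b a a ⟩
    b + (a + a)   ∎)

mirror-square : Mirror w b → Mirror w c → c + a ≡ b + b → a ≤ b →
                prefix w c ≡ prefix w b ++ drop a (prefix w b)
mirror-square {w = w} {c = c} {a = a} mirror-b mirror-c c+a≡b+b a≤b
  with d , refl ← m≤n⇒∃[o]m+o≡n a≤b = begin
  prefix w c                                           ≡⟨ cong (prefix w) c≡a+d+d ⟩
  prefix w (a + d + d)                                 ≡⟨ prefix-++ w (a + d) d ⟩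
  prefix w (a + d) ++ prefix (λ k → w (a + d + k)) d   ≡⟨ cong (prefix w (a + d) ++_) (prefix-cong periodic) ⟩
  prefix w (a + d) ++ prefix (λ k → w (a + k)) d       ≡⟨ cong (prefix w (a + d) ++_) (sym (drop-prefix w a d)) ⟩
  prefix w (a + d) ++ drop a (prefix w (a + d))        ∎
  where
  open ≡-Reasoning
  c≡a+d+d : c ≡ a + d + d
  c≡a+d+d = +-cancelʳ-≡ a c (a + d + d) (begin
    c + a               ≡⟨ c+a≡b+b ⟩
    a + d + (a + d)     ≡⟨ cong (a + d +_) (+-comm a d) ⟩
    a + d + (d + a)     ≡⟨ sym (+-assoc (a + d) d a) ⟩
    a + d + d + a       ∎)
  periodic : ∀ k → k < d → w (a + d + k) ≡ w (a + k)
  periodic k k<d = begin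
    w (a + d + k)     ≡⟨ cong w (trans (cong (_+ k) (+-comm a d)) (+-assoc d a k)) ⟩
    w (d + (a + k))   ≡⟨ mirror-period mirror-b (subst (Mirror w) c≡a+d+d mirror-c) (+-monoʳ-< a k<d) ⟩
    w (a + k)         ∎

lemma5p5 : {A : Set} (w : InfWord A) (n₀ n₁ n₂ : ℕ) →
    ConsecutivePalLengths w n₀ n₁ → ConsecutivePalLengths w n₁ n₂ →
    (prefix w n₂ ≡ prefix w n₁ ++ drop n₀ (prefix w n₁)) ⊎ (n₂ > n₀ + n₁)
lemma5p5 w n₀ n₁ n₂ (pal₀ , pal₁ , n₀<n₁ , gap₀₁) (_ , pal₂ , n₁<n₂ , gap₁₂)
  with n₀ + n₁ <? n₂ | <-cmp (n₂ + n₀) (n₁ + n₁)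
... | yes n₀+n₁<n₂ | _ = inj₂ n₀+n₁<n₂
... | no _ | tri≈ _ balanced _ =
  inj₁ (mirror-square (palindrome⇒mirror pal₁) (palindrome⇒mirror pal₂) balanced (<⇒≤ n₀<n₁))
... | no _ | tri< shorter _ _
  with m , n₀<m , m<n₁ , mirror-m ←
         mirror-in-lower-gap (palindrome⇒mirror pal₁) (palindrome⇒mirror pal₂) n₁<n₂ shorter
  = ⊥-elim (gap₀₁ m n₀<m m<n₁ (mirror⇒palindrome mirror-m))
... | no n₀+n₁≮n₂ | tri> _ _ longer
  with m , n₁<m , m<n₂ , mirror-m ←
         mirror-in-upper-gap (palindrome⇒mirror pal₀) (palindrome⇒mirror pal₁)
                             (palindrome⇒mirror pal₂) n₀<n₁ (≮⇒≥ n₀+n₁≮n₂) longer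
  = ⊥-elim (gap₁₂ m n₁<m m<n₂ (mirror⇒palindrome mirror-m))
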